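{- Let $G$ be the graph obtained from a cycle $C$ and a path $P$ with at least one edge by identifying an end vertex of $P$ with a vertex of $C$. Then $G$ is an AR-graph.
   Context: All graphs are finite, simple and undirected; $\mathbb{N}=\{1,2,3,\dots\}$. Let $f:E(G)\to\mathbb{N}$ be an injective edge labeling of a graph $G$. A vertex $v$ is an AR-vertex (under $f$) if, whenever $x_1,\dots,x_k$ are the labels of the $k$ edges incident on $v$, the $2^k$ sums $\sum_{i\in S}x_i$ over all subsets $S\subseteq\{1,\dots,k\}$ are pairwise distinct. An injective labeling $f$ is an AR-labeling if every vertex is an AR-vertex under $f$. A graph $G$ with $m$ edges is an AR-graph if it has an AR-labeling $f:E(G)\to\{1,2,\dots,m\}$. -}

module Defs where

open import Data.Nat using (ℕ; zero; suc; _+_; _∸_; _≤_; _<_; _≟_)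
open import Data.Bool using (Bool; true; false; _∨_)
open import Data.Fin using (Fin)
open import Data.Fin.Subset using (Subset)
open import Data.List using (List; []; _∷_; _++_; map; upTo; length; filter; allFin)
open import Data.Vec using (Vec; []; _∷_; fromList)
open import Data.Product using (_×_; _,_; proj₁; proj₂; Σ)
open import Relation.Nullary using (Dec; yes; no; _⊎-dec_)
open import Relation.Binary.PropositionalEquality using (_≡_)
open import Function.Definitions using (Injective)

-- A finite graph: vertex set {0,…,n-1}, edges listed as pairs of endpoints.
-- The i-th edge of the list has index i : Fin (number of edges).
record Graph : Set where
  constructor mkGraph
  field
    nV    : ℕ
    edges : List (ℕ × ℕ)

open Graph public

nE : Graph → ℕ
nE G = length (edges G)

edgeAt : (G : Graph) → Fin (nE G) → ℕ × ℕ
edgeAt G i = Data.List.lookup (edges G) i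

incident : ℕ → ℕ × ℕ → Set
incident v (a , b) = (v ≡ a) Data.Sum.⊎ (v ≡ b)
  where import Data.Sum

incident? : (v : ℕ) (e : ℕ × ℕ) → Dec (incident v e)
incident? v (a , b) = (v ≟ a) ⊎-dec (v ≟ b)

incidentEdges : (G : Graph) → ℕ → List (Fin (nE G))
incidentEdges G v = filter (λ i → incident? v (edgeAt G i)) (allFin (nE G))

subsetSum : ∀ {k} → Vec ℕ k → Subset k → ℕ
subsetSum [] [] = 0
subsetSum (x ∷ xs) (true ∷ S) = x + subsetSum xs S
subsetSum (x ∷ xs) (false ∷ S) = subsetSum xs S

distinctSubsetSums : ∀ {k} → Vec ℕ k → Set
distinctSubsetSums {k} xs = (S T : Subset k) → subsetSum xs S ≡ subsetSum xs T → S ≡ T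

incidentLabels : (G : Graph) → (Fin (nE G) → ℕ) → ℕ → List ℕ
incidentLabels G f v = map f (incidentEdges G v)

IsARVertex : (G : Graph) → (Fin (nE G) → ℕ) → ℕ → Set
IsARVertex G f v = distinctSubsetSums (fromList (incidentLabels G f v))

IsARLabeling : (G : Graph) → (Fin (nE G) → ℕ) → Set
IsARLabeling G f =
  Injective _≡_ _≡_ f
  × ((i : Fin (nE G)) → 1 ≤ f i × f i ≤ nE G)
  × ((v : ℕ) → v < nV G → IsARVertex G f v)

IsARGraph : Graph → Set
IsARGraph G = Σ (Fin (nE G) → ℕ) (IsARLabeling G)

cycleEdges : ℕ → List (ℕ × ℕ)
cycleEdges k = map (λ i → (i , suc i)) (upTo (k ∸ 1)) ++ ((k ∸ 1 , 0) ∷ [])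

-- Path P with l edges on vertices 0,k,k+1,…,k+l-1; its end vertex 0 is
-- identified with vertex 0 of the cycle.
pathEdges : ℕ → ℕ → List (ℕ × ℕ)
pathEdges k l = (0 , k) ∷ map (λ i → (k + i , k + suc i)) (upTo (l ∸ 1))

cycleWithPendantPath : ℕ → ℕ → Graph
cycleWithPendantPath k l = mkGraph (k + l) (cycleEdges k ++ pathEdges k l)

{-# OPTIONS --safe #-}

-- Orient the edges as they are listed: the cycle 0 → 1 → ⋯ → k−1 → 0, then the path
-- 0 → k → ⋯ → k+l−1.  Every vertex is the head of exactly one edge, so labelling each edge by its
-- head plus one is a bijection onto {1,…,k+l}.  The edges at a vertex v ∉ {0, k−1} have heads
-- among v and v+1, those at k−1 have heads k−1 and 0, and two distinct positive labels always
-- have distinct subset sums.  Vertex 0 carries the labels 2, 1 and k+1, and k+1 ≥ 4 is not a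
-- subset sum of {1, 2}.  Incident labels need only be bounded by a sublist, since a sublist of a
-- list with distinct subset sums has distinct subset sums.
module Submission where

open import Defs
open import Data.Nat using (ℕ; zero; suc; _+_; _≤_; _<_; _≟_; z≤n; s≤s; z<s)
open import Data.Nat.Properties
open import Data.Bool using (true; false)
open import Data.Fin using (Fin)
open import Data.Fin.Subset using (Subset)
open import Data.List using (List; []; _∷_; _++_; map; filter; allFin; applyUpTo; upTo; length; lookup)
open import Data.List.Properties
  using ( map-∘; map-++; map-tabulate; tabulate-lookup; length-++; ++-assoc
        ; filter-++; filter-accept; filter-reject; filter-none )
open import Data.List.Membership.Propositional.Properties using (∈-lookup; ∈-map⁺)
open import Data.List.Relation.Unary.All as All using (All; []; _∷_)
import Data.List.Relation.Unary.All.Properties as All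
open import Data.List.Relation.Unary.AllPairs using ([]; _∷_)
import Data.List.Relation.Unary.AllPairs.Properties as AllPairs
open import Data.List.Relation.Unary.Unique.Propositional using (Unique)
open import Data.List.Relation.Binary.Sublist.Propositional
  using (_⊆_; []; _∷_; _∷ʳ_; ⊆-reflexive)
import Data.List.Relation.Binary.Sublist.Propositional.Properties as Sublist
open import Data.Vec using (Vec; []; _∷_; fromList)
open import Data.Vec.Properties using (∷-injectiveˡ; ∷-injectiveʳ)
open import Data.Product using (_×_; _,_; proj₁; proj₂)
open import Data.Sum using (inj₁; inj₂; [_,_]′)
open import Relation.Nullary using (¬_; does; yes; no; contradiction)
open import Relation.Unary using (Pred; Decidable)
open import Relation.Binary.PropositionalEquality
open import Relation.Binary.Definitions using (tri<; tri≈; tri>)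
open import Function using (_∘_; id)
open import Level using (0ℓ)

distinctSubsetSums-[] : distinctSubsetSums []
distinctSubsetSums-[] [] [] _ = refl

distinctSubsetSums-∷ : ∀ {k x} {xs : Vec ℕ k} → distinctSubsetSums xs →
  (∀ S T → x + subsetSum xs S ≢ subsetSum xs T) → distinctSubsetSums (x ∷ xs)
distinctSubsetSums-∷ {x = x} dss _ (true ∷ S) (true ∷ T) eq =
  cong (true ∷_) (dss S T (+-cancelˡ-≡ x _ _ eq))
distinctSubsetSums-∷ dss _  (false ∷ S) (false ∷ T) eq = cong (false ∷_) (dss S T eq)
distinctSubsetSums-∷ _  x∉ (true ∷ S)  (false ∷ T) eq = contradiction eq (x∉ S T)
distinctSubsetSums-∷ _  x∉ (false ∷ S) (true ∷ T)  eq = contradiction (sym eq) (x∉ T S)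

distinctSubsetSums-pair : ∀ {x y} → 0 < x → 0 < y → x ≢ y → distinctSubsetSums (x ∷ y ∷ [])
distinctSubsetSums-pair {suc x} {suc y} _ _ x≢y = distinctSubsetSums-∷ singleton x∉
  where
  singleton : distinctSubsetSums (suc y ∷ [])
  singleton = distinctSubsetSums-∷ distinctSubsetSums-[] λ { [] [] () }
  x∉ : ∀ S T → suc x + subsetSum (suc y ∷ []) S ≢ subsetSum (suc y ∷ []) T
  x∉ (false ∷ []) (false ∷ []) ()
  x∉ (false ∷ []) (true ∷ [])  eq = x≢y (+-cancelʳ-≡ 0 _ _ eq)
  x∉ (true ∷ [])  (false ∷ []) ()
  x∉ (true ∷ [])  (true ∷ [])  eq with () ← +-cancelʳ-≡ (suc y + 0) (suc x) 0 eq

distinctSubsetSums-2∷1∷ : ∀ {m} → 4 ≤ m → distinctSubsetSums (2 ∷ 1 ∷ m ∷ [])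
distinctSubsetSums-2∷1∷ {m} (s≤s (s≤s (s≤s (s≤s _)))) =
  distinctSubsetSums-∷ (distinctSubsetSums-pair z<s z<s λ ()) 2∉
  where
  2∉ : ∀ S T → 2 + subsetSum (1 ∷ m ∷ []) S ≢ subsetSum (1 ∷ m ∷ []) T
  2∉ (false ∷ false ∷ []) (false ∷ false ∷ []) ()
  2∉ (false ∷ false ∷ []) (true  ∷ false ∷ []) ()
  2∉ (false ∷ false ∷ []) (false ∷ true  ∷ []) ()
  2∉ (false ∷ false ∷ []) (true  ∷ true  ∷ []) ()
  2∉ (true  ∷ false ∷ []) (false ∷ false ∷ []) ()
  2∉ (true  ∷ false ∷ []) (true  ∷ false ∷ []) ()
  2∉ (true  ∷ false ∷ []) (false ∷ true  ∷ []) ()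
  2∉ (true  ∷ false ∷ []) (true  ∷ true  ∷ []) ()
  2∉ (false ∷ true  ∷ []) (false ∷ false ∷ []) ()
  2∉ (false ∷ true  ∷ []) (true  ∷ false ∷ []) ()
  2∉ (false ∷ true  ∷ []) (false ∷ true  ∷ []) eq with () ← +-cancelʳ-≡ (m + 0) 2 0 eq
  2∉ (false ∷ true  ∷ []) (true  ∷ true  ∷ []) eq with () ← +-cancelʳ-≡ (m + 0) 2 1 eq
  2∉ (true  ∷ true  ∷ []) (false ∷ false ∷ []) ()
  2∉ (true  ∷ true  ∷ []) (true  ∷ false ∷ []) ()
  2∉ (true  ∷ true  ∷ []) (false ∷ true  ∷ []) eq with () ← +-cancelʳ-≡ (m + 0) 3 0 eq
  2∉ (true  ∷ true  ∷ []) (true  ∷ true  ∷ []) eq with () ← +-cancelʳ-≡ (m + 0) 3 1 eq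

embedSubset : ∀ {xs ys : List ℕ} → xs ⊆ ys → Subset (length xs) → Subset (length ys)
embedSubset []       []      = []
embedSubset (_ ∷ʳ p) S       = false ∷ embedSubset p S
embedSubset (_ ∷ p)  (b ∷ S) = b ∷ embedSubset p S

subsetSum-embedSubset : ∀ {xs ys : List ℕ} (p : xs ⊆ ys) S →
  subsetSum (fromList ys) (embedSubset p S) ≡ subsetSum (fromList xs) S
subsetSum-embedSubset []         []          = refl
subsetSum-embedSubset (_ ∷ʳ p)   S           = subsetSum-embedSubset p S
subsetSum-embedSubset (refl ∷ p) (true ∷ S)  = cong (_ +_) (subsetSum-embedSubset p S)
subsetSum-embedSubset (refl ∷ p) (false ∷ S) = subsetSum-embedSubset p S

embedSubset-injective : ∀ {xs ys : List ℕ} (p : xs ⊆ ys) {S T} →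
  embedSubset p S ≡ embedSubset p T → S ≡ T
embedSubset-injective []       {[]}    {[]}    _  = refl
embedSubset-injective (_ ∷ʳ p)                 eq = embedSubset-injective p (∷-injectiveʳ eq)
embedSubset-injective (_ ∷ p)  {_ ∷ _} {_ ∷ _} eq =
  cong₂ _∷_ (∷-injectiveˡ eq) (embedSubset-injective p (∷-injectiveʳ eq))

distinctSubsetSums-⊆ : ∀ {xs ys : List ℕ} → xs ⊆ ys →
  distinctSubsetSums (fromList ys) → distinctSubsetSums (fromList xs)
distinctSubsetSums-⊆ {xs} {ys} p dss S T eq =
  embedSubset-injective p (dss (embedSubset p S) (embedSubset p T) (begin
    subsetSum (fromList ys) (embedSubset p S)  ≡⟨ subsetSum-embedSubset p S ⟩
    subsetSum (fromList xs) S                  ≡⟨ eq ⟩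
    subsetSum (fromList xs) T                  ≡⟨ subsetSum-embedSubset p T ⟨
    subsetSum (fromList ys) (embedSubset p T)  ∎))
  where open ≡-Reasoning

map-filter : ∀ {A B : Set} {P : Pred B 0ℓ} (g : A → B) (P? : Decidable P) xs →
  map g (filter (P? ∘ g) xs) ≡ filter P? (map g xs)
map-filter g P? []       = refl
map-filter g P? (x ∷ xs) with does (P? (g x))
... | true  = cong (g x ∷_) (map-filter g P? xs)
... | false = map-filter g P? xs

incidentLabels-∘edgeAt : ∀ G (label : ℕ × ℕ → ℕ) v →
  incidentLabels G (label ∘ edgeAt G) v ≡ map label (filter (incident? v) (edges G))
incidentLabels-∘edgeAt G label v = begin
  map (label ∘ lookup es) (filter (incident? v ∘ lookup es) (allFin _))
    ≡⟨ map-∘ _ ⟩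
  map label (map (lookup es) (filter (incident? v ∘ lookup es) (allFin _)))
    ≡⟨ cong (map label) (map-filter (lookup es) (incident? v) (allFin _)) ⟩
  map label (filter (incident? v) (map (lookup es) (allFin _)))
    ≡⟨ cong (map label ∘ filter (incident? v))
            (trans (map-tabulate id (lookup es)) (tabulate-lookup es)) ⟩
  map label (filter (incident? v) es) ∎
  where
  open ≡-Reasoning
  es = edges G

Unique-map⇒lookup-injective : ∀ {A B : Set} (g : A → B) (xs : List A) → Unique (map g xs) →
  ∀ {i j} → g (lookup xs i) ≡ g (lookup xs j) → i ≡ j
Unique-map⇒lookup-injective g (x ∷ xs) (_ ∷ _)    {Fin.zero}  {Fin.zero}  _  = refl
Unique-map⇒lookup-injective g (x ∷ xs) (gx∉ ∷ _)  {Fin.zero}  {Fin.suc j} eq =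
  contradiction eq (All.lookup gx∉ (∈-map⁺ g (∈-lookup j)))
Unique-map⇒lookup-injective g (x ∷ xs) (gx∉ ∷ _)  {Fin.suc i} {Fin.zero}  eq =
  contradiction (sym eq) (All.lookup gx∉ (∈-map⁺ g (∈-lookup i)))
Unique-map⇒lookup-injective g (x ∷ xs) (_ ∷ u)    {Fin.suc i} {Fin.suc j} eq =
  cong Fin.suc (Unique-map⇒lookup-injective g xs u eq)

-- Opaque, so that the lemmas below are matched against headsAt rather than the unfolded filter.
opaque
  headsAt : ℕ → List (ℕ × ℕ) → List ℕ
  headsAt v es = map proj₂ (filter (incident? v) es)

  incidentLabels-headLabelling : ∀ G v →
    incidentLabels G (suc ∘ proj₂ ∘ edgeAt G) v ≡ map suc (headsAt v (edges G))
  incidentLabels-headLabelling G v = trans (incidentLabels-∘edgeAt G (suc ∘ proj₂) v) (map-∘ _)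

  headsAt-none : ∀ {v es} → All (λ e → ¬ incident v e) es → headsAt v es ⊆ []
  headsAt-none {v} none = ⊆-reflexive (cong (map proj₂) (filter-none (incident? v) none))

  headsAt-accept : ∀ {v e es ys} → incident v e → headsAt v es ⊆ ys →
                   headsAt v (e ∷ es) ⊆ proj₂ e ∷ ys
  headsAt-accept {v} p s =
    subst (_⊆ _) (sym (cong (map proj₂) (filter-accept (incident? v) p))) (refl ∷ s)

  headsAt-reject : ∀ {v e es ys} → ¬ incident v e → headsAt v es ⊆ ys → headsAt v (e ∷ es) ⊆ ys
  headsAt-reject {v} ¬p s =
    subst (_⊆ _) (sym (cong (map proj₂) (filter-reject (incident? v) ¬p))) s

  headsAt-++ : ∀ {v es es′ ys ys′} → headsAt v es ⊆ ys → headsAt v es′ ⊆ ys′ →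
               headsAt v (es ++ es′) ⊆ ys ++ ys′
  headsAt-++ {v} {es} {es′} s s′ = subst (_⊆ _) (sym (begin
    map proj₂ (filter (incident? v) (es ++ es′))
      ≡⟨ cong (map proj₂) (filter-++ (incident? v) es es′) ⟩
    map proj₂ (filter (incident? v) es ++ filter (incident? v) es′)
      ≡⟨ map-++ proj₂ (filter (incident? v) es) (filter (incident? v) es′) ⟩
    headsAt v es ++ headsAt v es′ ∎))
    (Sublist.++⁺ s s′)
    where open ≡-Reasoning

  headsAt-[] : ∀ {v ys} → headsAt v [] ⊆ ys
  headsAt-[] = Sublist.[]⊆-universal _

headLabelling-isARGraph : ∀ n es → Unique (map proj₂ es) → All (λ e → proj₂ e < length es) es →
  (∀ v → v < n → distinctSubsetSums (fromList (map suc (headsAt v es)))) →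
  IsARGraph (mkGraph n es)
headLabelling-isARGraph n es unique bounded headsDistinct = f , f-injective , f-bounded , f-AR
  where
  f : Fin (length es) → ℕ
  f i = suc (proj₂ (lookup es i))
  f-injective : ∀ {i j} → f i ≡ f j → i ≡ j
  f-injective eq = Unique-map⇒lookup-injective proj₂ es unique (suc-injective eq)
  f-bounded : ∀ i → 1 ≤ f i × f i ≤ length es
  f-bounded i = s≤s z≤n , All.lookup bounded (∈-lookup i)
  f-AR : ∀ v → v < n → IsARVertex (mkGraph n es) f v
  f-AR v v<n = subst (distinctSubsetSums ∘ fromList)
    (sym (incidentLabels-headLabelling (mkGraph n es) v))
    (headsDistinct v v<n)

pathFrom : ℕ → ℕ → List (ℕ × ℕ)
pathFrom a zero    = []
pathFrom a (suc c) = (a , suc a) ∷ pathFrom (suc a) c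

map-upTo≡pathFrom : ∀ a c → map (λ i → (a + i , a + suc i)) (upTo c) ≡ pathFrom a c
map-upTo≡pathFrom a c = go a c _ id (λ i → cong (a + i ,_) (+-suc a i))
  where
  go : ∀ a c (g : ℕ → ℕ × ℕ) (h : ℕ → ℕ) → (∀ i → g (h i) ≡ (a + i , suc (a + i))) →
       map g (applyUpTo h c) ≡ pathFrom a c
  go a zero    g h gh≡ = refl
  go a (suc c) g h gh≡ = cong₂ _∷_
    (trans (gh≡ 0) (cong (λ x → x , suc x) (+-identityʳ a)))
    (go (suc a) c g (h ∘ suc) (λ i → trans (gh≡ (suc i)) (cong (λ x → x , suc x) (+-suc a i))))

length-pathFrom : ∀ a c → length (pathFrom a c) ≡ c
length-pathFrom a zero    = refl
length-pathFrom a (suc c) = cong suc (length-pathFrom (suc a) c)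

All-pathFrom : ∀ {P : Pred (ℕ × ℕ) 0ℓ} a c → (∀ {x} → a ≤ x → x < a + c → P (x , suc x)) →
               All P (pathFrom a c)
All-pathFrom a zero    _ = []
All-pathFrom a (suc c) p = p ≤-refl (m<m+n a z<s) ∷
  All-pathFrom (suc a) c (λ a<x x<1+a+c → p (<⇒≤ a<x) (subst (_<_ _) (sym (+-suc a c)) x<1+a+c))

¬incident : ∀ {v a b} → v ≢ a → v ≢ b → ¬ incident v (a , b)
¬incident v≢a v≢b = [ v≢a , v≢b ]′

pathFrom-avoids-below : ∀ {v a} c → v < a → All (λ e → ¬ incident v e) (pathFrom a c)
pathFrom-avoids-below c v<a = All-pathFrom _ c λ a≤x _ →
  ¬incident (<⇒≢ (<-≤-trans v<a a≤x)) (<⇒≢ (<-≤-trans v<a (m≤n⇒m≤1+n a≤x)))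

pathFrom-avoids-above : ∀ {v} a c → a + c < v → All (λ e → ¬ incident v e) (pathFrom a c)
pathFrom-avoids-above a c a+c<v = All-pathFrom a c λ _ x<a+c →
  ¬incident (>⇒≢ (<-trans x<a+c a+c<v)) (>⇒≢ (≤-<-trans x<a+c a+c<v))

headsAt-pathFrom-start : ∀ a c → headsAt a (pathFrom a c) ⊆ suc a ∷ []
headsAt-pathFrom-start a zero    = headsAt-[]
headsAt-pathFrom-start a (suc c) =
  headsAt-accept (inj₁ refl) (headsAt-none (pathFrom-avoids-below c (n<1+n a)))

headsAt-pathFrom-end : ∀ a c → headsAt (a + c) (pathFrom a c) ⊆ a + c ∷ []
headsAt-pathFrom-end a zero    = headsAt-[]
headsAt-pathFrom-end a (suc zero) rewrite +-comm a 1 = headsAt-accept (inj₂ refl) headsAt-[]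
headsAt-pathFrom-end a (suc (suc c)) =
  subst (λ v → headsAt v (pathFrom a (suc (suc c))) ⊆ v ∷ []) (sym (+-suc a (suc c)))
    (headsAt-reject (¬incident (≢-sym (m≢1+m+n a)) (m+1+n≢m a ∘ suc-injective))
      (headsAt-pathFrom-end (suc a) (suc c)))

headsAt-pathFrom : ∀ {v} a c → headsAt v (pathFrom a c) ⊆ v ∷ suc v ∷ []
headsAt-pathFrom     a zero    = headsAt-[]
headsAt-pathFrom {v} a (suc c) with v ≟ a | v ≟ suc a
... | yes refl | _        = _ ∷ʳ headsAt-pathFrom-start a (suc c)
... | no _     | yes refl = headsAt-accept (inj₂ refl) (headsAt-pathFrom-start (suc a) c)
... | no v≢a   | no v≢1+a = headsAt-reject (¬incident v≢a v≢1+a) (headsAt-pathFrom (suc a) c)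

pathHeads-bounded : ∀ a c → All (λ h → a < h × h ≤ a + c) (map proj₂ (pathFrom a c))
pathHeads-bounded a c = All.map⁺ (All-pathFrom a c λ a≤x x<a+c → s≤s a≤x , x<a+c)

pathHeads-unique : ∀ a c → Unique (map proj₂ (pathFrom a c))
pathHeads-unique a zero    = []
pathHeads-unique a (suc c) =
  All.map (<⇒≢ ∘ proj₁) (pathHeads-bounded (suc a) c) ∷ pathHeads-unique (suc a) c

module _ (K l′ : ℕ) where

  tadpoleEdges : List (ℕ × ℕ)
  tadpoleEdges = pathFrom 0 K ++ (K , 0) ∷ (0 , suc K) ∷ pathFrom (suc K) l′

  cycleWithPendantPath-edges : edges (cycleWithPendantPath (suc K) (suc l′)) ≡ tadpoleEdges
  cycleWithPendantPath-edges =
    trans (++-assoc (map (λ i → (i , suc i)) (upTo K)) ((K , 0) ∷ []) _)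
          (cong₂ (λ P Q → P ++ (K , 0) ∷ (0 , suc K) ∷ Q)
                 (map-upTo≡pathFrom 0 K) (map-upTo≡pathFrom (suc K) l′))

  length-tadpoleEdges : length tadpoleEdges ≡ suc K + suc l′
  length-tadpoleEdges = begin
    length tadpoleEdges                                     ≡⟨ length-++ (pathFrom 0 K) ⟩
    length (pathFrom 0 K) + suc (suc (length (pathFrom (suc K) l′)))
      ≡⟨ cong₂ (λ p q → p + suc (suc q)) (length-pathFrom 0 K) (length-pathFrom (suc K) l′) ⟩
    K + suc (suc l′)                                        ≡⟨ +-suc K (suc l′) ⟩
    suc K + suc l′                                          ∎
    where open ≡-Reasoning

  tadpoleHeads-bounded : All (λ e → proj₂ e < length tadpoleEdges) tadpoleEdges
  tadpoleHeads-bounded =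
    subst (λ m → All (λ e → proj₂ e < m) tadpoleEdges) (sym length-tadpoleEdges)
      (All.++⁺ (All-pathFrom 0 K λ _ x<K → s≤s (≤-trans x<K (m≤m+n K (suc l′))))
        (z<s ∷ m<m+n (suc K) z<s ∷
         All-pathFrom (suc K) l′ λ _ x<1+K+l′ →
           subst (_<_ _) (sym (+-suc (suc K) l′)) (s≤s x<1+K+l′)))

  tadpoleHeads-unique : Unique (map proj₂ tadpoleEdges)
  tadpoleHeads-unique = subst Unique (sym (map-++ proj₂ (pathFrom 0 K) _))
    (AllPairs.++⁺ (pathHeads-unique 0 K) (0∉ ∷ 1+K∉ ∷ pathHeads-unique (suc K) l′) cycle∉path)
    where
    pathHeads>1+K = All.map proj₁ (pathHeads-bounded (suc K) l′)
    0∉ : All (0 ≢_) (suc K ∷ map proj₂ (pathFrom (suc K) l′))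
    0∉ = (λ ()) ∷ All.map (λ 1+K<h → <⇒≢ (≤-<-trans z≤n 1+K<h)) pathHeads>1+K
    1+K∉ : All (suc K ≢_) (map proj₂ (pathFrom (suc K) l′))
    1+K∉ = All.map <⇒≢ pathHeads>1+K
    cycle∉path : All (λ x → All (x ≢_) (0 ∷ suc K ∷ map proj₂ (pathFrom (suc K) l′)))
                     (map proj₂ (pathFrom 0 K))
    cycle∉path = All.map (λ { (0<x , x≤K) → >⇒≢ 0<x ∷ <⇒≢ (s≤s x≤K) ∷
                                 All.map (λ 1+K<h → <⇒≢ (<-trans (s≤s x≤K) 1+K<h)) pathHeads>1+K })
                         (pathHeads-bounded 0 K)

  headsAt-tadpole-0 : headsAt 0 tadpoleEdges ⊆ 1 ∷ 0 ∷ suc K ∷ []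
  headsAt-tadpole-0 = headsAt-++ (headsAt-pathFrom-start 0 K)
    (headsAt-accept (inj₂ refl)
      (headsAt-accept (inj₁ refl) (headsAt-none (pathFrom-avoids-below l′ z<s))))

  headsAt-tadpole-K : 0 < K → headsAt K tadpoleEdges ⊆ K ∷ 0 ∷ []
  headsAt-tadpole-K 0<K = headsAt-++ (headsAt-pathFrom-end 0 K)
    (headsAt-accept (inj₁ refl) (headsAt-reject (¬incident (>⇒≢ 0<K) (<⇒≢ (n<1+n K)))
      (headsAt-none (pathFrom-avoids-below l′ (n<1+n K)))))

  headsAt-tadpole-other : ∀ v → v ≢ 0 → v ≢ K → headsAt v tadpoleEdges ⊆ v ∷ suc v ∷ []
  headsAt-tadpole-other v v≢0 v≢K with <-cmp v K
  ... | tri< v<K _ _ = headsAt-++ (headsAt-pathFrom 0 K)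
        (headsAt-reject (¬incident v≢K v≢0)
          (headsAt-reject (¬incident v≢0 (<⇒≢ (m<n⇒m<1+n v<K)))
            (headsAt-none (pathFrom-avoids-below l′ (m<n⇒m<1+n v<K)))))
  ... | tri≈ _ v≡K _ = contradiction v≡K v≢K
  ... | tri> _ _ K<v with m≤n⇒m<n∨m≡n K<v
  ...   | inj₂ refl = headsAt-++ (headsAt-none (pathFrom-avoids-above 0 K K<v))
          (headsAt-reject (¬incident (>⇒≢ K<v) v≢0)
            (headsAt-accept (inj₂ refl) (headsAt-pathFrom-start (suc K) l′)))
  ...   | inj₁ 1+K<v = headsAt-++ (headsAt-none (pathFrom-avoids-above 0 K K<v))
          (headsAt-reject (¬incident (>⇒≢ K<v) v≢0)
            (headsAt-reject (¬incident v≢0 (>⇒≢ 1+K<v)) (headsAt-pathFrom (suc K) l′)))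

  tadpole-distinctSubsetSums : 2 ≤ K → ∀ v →
    distinctSubsetSums (fromList (map suc (headsAt v tadpoleEdges)))
  tadpole-distinctSubsetSums 2≤K zero =
    distinctSubsetSums-⊆ (Sublist.map⁺ suc headsAt-tadpole-0)
      (distinctSubsetSums-2∷1∷ (s≤s (s≤s 2≤K)))
  tadpole-distinctSubsetSums 2≤K (suc w) with suc w ≟ K
  ... | yes 1+w≡K =
        subst (λ v → distinctSubsetSums (fromList (map suc (headsAt v tadpoleEdges)))) (sym 1+w≡K)
          (distinctSubsetSums-⊆ (Sublist.map⁺ suc (headsAt-tadpole-K 0<K))
            (distinctSubsetSums-pair z<s z<s (>⇒≢ 0<K ∘ suc-injective)))
    where 0<K = <-≤-trans z<s 2≤K
  ... | no 1+w≢K =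
        distinctSubsetSums-⊆ (Sublist.map⁺ suc (headsAt-tadpole-other (suc w) (λ ()) 1+w≢K))
          (distinctSubsetSums-pair z<s z<s (<⇒≢ (n<1+n _)))

mainTheorem16 : (k l : ℕ) → 3 ≤ k → 1 ≤ l → IsARGraph (cycleWithPendantPath k l)
mainTheorem16 (suc K) (suc l′) (s≤s 2≤K) _ =
  subst (IsARGraph ∘ mkGraph (suc K + suc l′)) (sym (cycleWithPendantPath-edges K l′))
    (headLabelling-isARGraph _ (tadpoleEdges K l′)
      (tadpoleHeads-unique K l′) (tadpoleHeads-bounded K l′)
      (λ v _ → tadpole-distinctSubsetSums K l′ 2≤K v))
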